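{- A perfect cuboid exists if and only if there exist rational numbers $\alpha_3,\beta_3,\gamma_3\in\mathbb{Q}\setminus\{0,1,-1\}$ satisfying $$\Big(\frac{1-\gamma_3^2}{2\gamma_3}\Big)^2+\Big(\frac{1-\beta_3^2}{2\beta_3}\Big)^2=\Big(\frac{1-\alpha_3^2}{2\alpha_3}\Big)^2.$$
   Context: A perfect cuboid is a triple of positive rational numbers $a,b,c$ such that $a^2+b^2$, $b^2+c^2$, $a^2+c^2$ and $a^2+b^2+c^2$ are all squares of rational numbers. -}

module Defs where

open import Data.Rational using (ℚ; 0ℚ; 1ℚ; ½; _+_; _-_; _*_; -_; 1/_; ≢-nonZero)
open import Data.Product using (∃; Σ; _×_; _,_; proj₁)
open import Relation.Binary.PropositionalEquality using (_≡_; _≢_)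

IsSquare : ℚ → Set
IsSquare x = ∃ λ r → r * r ≡ x

record PerfectCuboid (a b c : ℚ) : Set where
  field
    a-pos : 0ℚ Data.Rational.< a
    b-pos : 0ℚ Data.Rational.< b
    c-pos : 0ℚ Data.Rational.< c
    ab-sq : IsSquare (a * a + b * b)
    bc-sq : IsSquare (b * b + c * c)
    ac-sq : IsSquare (a * a + c * c)
    abc-sq : IsSquare (a * a + b * b + c * c)

PerfectCuboidExists : Set
PerfectCuboidExists = ∃ λ a → ∃ λ b → ∃ λ c → PerfectCuboid a b c

g : (x : ℚ) → x ≢ 0ℚ → ℚ
g x x≢0 = (1ℚ - x * x) * ½ * (1/_ x {{≢-nonZero x≢0}})

Admissible : ℚ → Set
Admissible x = (x ≢ 0ℚ) × (x ≢ 1ℚ) × (x ≢ - 1ℚ)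

CuboidEquation : Set
CuboidEquation =
  ∃ λ α → ∃ λ β → ∃ λ γ →
    Σ (Admissible α) λ hα →
    Σ (Admissible β) λ hβ →
    Σ (Admissible γ) λ hγ →
      g γ (proj₁ hγ) * g γ (proj₁ hγ) + g β (proj₁ hβ) * g β (proj₁ hβ)
        ≡ g α (proj₁ hα) * g α (proj₁ hα)

{-# OPTIONS --safe #-}
module Submission where

-- Scaling a perfect cuboid so that one edge is 1 leaves nonzero rationals X, Y, Z
-- with X² + Y² = Z² such that 1 + X², 1 + Y² and 1 + Z² are squares. The nonzero t
-- with 1 + t² a square are exactly the values g x = (1 - x²)/(2x) at x ∉ {0, 1, -1}:
-- 1 + (g x)² = ((1 + x²)/(2x))², and conversely s² = 1 + t² gives g (s - t) = t.

open import Defs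
open import Algebra.Properties.Group using (x∙y⁻¹≈ε⇒x≈y; inverseʳ-unique)
open import Data.Product using (∃; Σ; _×_; _,_; proj₁; proj₂)
open import Data.Rational
  using (ℚ; 0ℚ; 1ℚ; ½; _+_; _-_; _*_; -_; 1/_; _÷_; ∣_∣; _<_; NonZero; Positive; ≢-nonZero; >-nonZero; positive)
open import Data.Rational.Properties
open import Data.Rational.Solver using (module +-*-Solver)
open import Data.Sum as Sum using (_⊎_; inj₁; inj₂; [_,_]′)
open import Function using (_∘_)
open import Relation.Binary.PropositionalEquality
open import Relation.Nullary using (¬_; yes; no)

open +-*-Solver
open ≡-Reasoning

p*q≡0⇒p≡0 : ∀ p q .{{_ : NonZero q}} → p * q ≡ 0ℚ → p ≡ 0ℚ
p*q≡0⇒p≡0 p q pq≡0 = begin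
  p              ≡⟨ *-identityʳ p ⟨
  p * 1ℚ         ≡⟨ cong (p *_) (*-inverseʳ q) ⟨
  p * (q * 1/ q) ≡⟨ *-assoc p q (1/ q) ⟨
  p * q * 1/ q   ≡⟨ cong (_* 1/ q) pq≡0 ⟩
  0ℚ * 1/ q      ≡⟨ *-zeroˡ (1/ q) ⟩
  0ℚ             ∎

p*q≡0⇒p≡0∨q≡0 : ∀ p q → p * q ≡ 0ℚ → p ≡ 0ℚ ⊎ q ≡ 0ℚ
p*q≡0⇒p≡0∨q≡0 p q pq≡0 with q ≟ 0ℚ
... | yes q≡0 = inj₂ q≡0
... | no  q≢0 = inj₁ (p*q≡0⇒p≡0 p q {{≢-nonZero q≢0}} pq≡0)

1-x*x≡0⇒x≡±1 : ∀ x → 1ℚ - x * x ≡ 0ℚ → x ≡ 1ℚ ⊎ x ≡ - 1ℚ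
1-x*x≡0⇒x≡±1 x 1-x²≡0 =
  Sum.map (sym ∘ x∙y⁻¹≈ε⇒x≈y +-0-group 1ℚ x) (inverseʳ-unique +-0-group 1ℚ x)
    (p*q≡0⇒p≡0∨q≡0 (1ℚ - x) (1ℚ + x) (begin
      (1ℚ - x) * (1ℚ + x) ≡⟨ solve 1 (λ x → (con 1ℚ :- x) :* (con 1ℚ :+ x) := con 1ℚ :- x :* x) refl x ⟩
      1ℚ - x * x          ≡⟨ 1-x²≡0 ⟩
      0ℚ                  ∎))

x≡±1⇒1-x*x≡0 : ∀ {x} → x ≡ 1ℚ ⊎ x ≡ - 1ℚ → 1ℚ - x * x ≡ 0ℚ
x≡±1⇒1-x*x≡0 (inj₁ refl) = refl
x≡±1⇒1-x*x≡0 (inj₂ refl) = refl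

∣p∣*∣p∣≡p*p : ∀ p → ∣ p ∣ * ∣ p ∣ ≡ p * p
∣p∣*∣p∣≡p*p p with ∣p∣≡p∨∣p∣≡-p p
... | inj₁ ∣p∣≡p  = cong (λ q → q * q) ∣p∣≡p
... | inj₂ ∣p∣≡-p =
  trans (cong (λ q → q * q) ∣p∣≡-p) (solve 1 (λ p → (:- p) :* (:- p) := p :* p) refl p)

0<∣p∣ : ∀ {p} → p ≢ 0ℚ → 0ℚ < ∣ p ∣
0<∣p∣ {p} p≢0 = positive⁻¹ ∣ p ∣
  {{nonNeg∧nonZero⇒pos ∣ p ∣ {{∣-∣-nonNeg p}} {{≢-nonZero (p≢0 ∘ ∣p∣≡0⇒p≡0 p)}}}}

scale-pythagorean : ∀ {u v w} k → w * w ≡ u * u + v * v →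
                    (w * k) * (w * k) ≡ (u * k) * (u * k) + (v * k) * (v * k)
scale-pythagorean {u} {v} {w} k w²≡u²+v² = begin
  (w * k) * (w * k)                     ≡⟨ solve 2 (λ w k → (w :* k) :* (w :* k) := (w :* w) :* (k :* k)) refl w k ⟩
  (w * w) * (k * k)                     ≡⟨ cong (_* (k * k)) w²≡u²+v² ⟩
  (u * u + v * v) * (k * k)             ≡⟨ solve 3 (λ u v k → (u :* u :+ v :* v) :* (k :* k) := (u :* k) :* (u :* k) :+ (v :* k) :* (v :* k)) refl u v k ⟩
  (u * k) * (u * k) + (v * k) * (v * k) ∎

UnitLeg : ℚ → Set
UnitLeg t = t ≢ 0ℚ × IsSquare (1ℚ + t * t)

unitLeg-÷ : ∀ u c .{{_ : NonZero c}} → u ≢ 0ℚ → IsSquare (u * u + c * c) → UnitLeg (u ÷ c)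
unitLeg-÷ u c u≢0 (w , w²≡u²+c²) = u≢0 ∘ p*q≡0⇒p≡0 u (1/ c) {{nonZero⇒1/nonZero c}} , w ÷ c , (begin
  (w ÷ c) * (w ÷ c)                     ≡⟨ scale-pythagorean {u} {c} {w} (1/ c) w²≡u²+c² ⟩
  (u ÷ c) * (u ÷ c) + (c ÷ c) * (c ÷ c) ≡⟨ cong (λ y → (u ÷ c) * (u ÷ c) + y * y) (*-inverseʳ c) ⟩
  (u ÷ c) * (u ÷ c) + 1ℚ                ≡⟨ +-comm ((u ÷ c) * (u ÷ c)) 1ℚ ⟩
  1ℚ + (u ÷ c) * (u ÷ c)                ∎)

g*[x+x]≡1-x*x : ∀ x (x≢0 : x ≢ 0ℚ) → g x x≢0 * (x + x) ≡ 1ℚ - x * x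
g*[x+x]≡1-x*x x x≢0 = begin
  (1ℚ - x * x) * ½ * 1/ x * (x + x) ≡⟨ solve 2 (λ x i → (con 1ℚ :- x :* x) :* con ½ :* i :* (x :+ x) := (con 1ℚ :- x :* x) :* (x :* i)) refl x (1/ x) ⟩
  (1ℚ - x * x) * (x * 1/ x)         ≡⟨ cong ((1ℚ - x * x) *_) (*-inverseʳ x) ⟩
  (1ℚ - x * x) * 1ℚ                 ≡⟨ *-identityʳ (1ℚ - x * x) ⟩
  1ℚ - x * x                        ∎
  where instance _ = ≢-nonZero x≢0

g≡-intro : ∀ x (x≢0 : x ≢ 0ℚ) {t} → 1ℚ - x * x ≡ t * (x + x) → g x x≢0 ≡ t
g≡-intro x x≢0 {t} 1-x²≡t[x+x] = begin
  (1ℚ - x * x) * ½ * 1/ x ≡⟨ cong (λ y → y * ½ * 1/ x) 1-x²≡t[x+x] ⟩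
  t * (x + x) * ½ * 1/ x  ≡⟨ solve 3 (λ t x i → t :* (x :+ x) :* con ½ :* i := t :* (x :* i)) refl t x (1/ x) ⟩
  t * (x * 1/ x)          ≡⟨ cong (t *_) (*-inverseʳ x) ⟩
  t * 1ℚ                  ≡⟨ *-identityʳ t ⟩
  t                       ∎
  where instance _ = ≢-nonZero x≢0

g≢0 : ∀ x (hx : Admissible x) → g x (proj₁ hx) ≢ 0ℚ
g≢0 x (x≢0 , x≢1 , x≢-1) gx≡0 = [ x≢1 , x≢-1 ]′ (1-x*x≡0⇒x≡±1 x (begin
  1ℚ - x * x         ≡⟨ g*[x+x]≡1-x*x x x≢0 ⟨
  g x x≢0 * (x + x)  ≡⟨ cong (_* (x + x)) gx≡0 ⟩
  0ℚ * (x + x)       ≡⟨ *-zeroˡ (x + x) ⟩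
  0ℚ                 ∎))

-- With h = (x⁻¹ + x)/2 and g x = (x⁻¹ - x)/2 we get h² - (g x)² = x⁻¹ x = 1.
1+g*g-square : ∀ x (x≢0 : x ≢ 0ℚ) → IsSquare (1ℚ + g x x≢0 * g x x≢0)
1+g*g-square x x≢0 = h , (begin
  h * h                                       ≡⟨ solve 2 (λ x i → ((con 1ℚ :+ x :* x) :* con ½ :* i) :* ((con 1ℚ :+ x :* x) :* con ½ :* i) := (x :* i) :* (x :* i) :+ ((con 1ℚ :- x :* x) :* con ½ :* i) :* ((con 1ℚ :- x :* x) :* con ½ :* i)) refl x (1/ x) ⟩
  (x * 1/ x) * (x * 1/ x) + g x x≢0 * g x x≢0 ≡⟨ cong (λ y → y * y + g x x≢0 * g x x≢0) (*-inverseʳ x) ⟩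
  1ℚ + g x x≢0 * g x x≢0                      ∎)
  where
  instance _ = ≢-nonZero x≢0
  h : ℚ
  h = (1ℚ + x * x) * ½ * 1/ x

unitLeg-g : ∀ x (hx : Admissible x) → UnitLeg (g x (proj₁ hx))
unitLeg-g x hx = g≢0 x hx , 1+g*g-square x (proj₁ hx)

Fibre-g : ℚ → Set
Fibre-g t = Σ ℚ λ x → Σ (Admissible x) λ hx → g x (proj₁ hx) ≡ t

unitLeg⇒g-fibre : ∀ {t} → UnitLeg t → Fibre-g t
unitLeg⇒g-fibre {t} (t≢0 , s , s²≡1+t²) = x , (x≢0 , x≢±1 ∘ inj₁ , x≢±1 ∘ inj₂) , gx≡t
  where
  x : ℚ
  x = s - t

  1-x²≡t[x+x] : 1ℚ - x * x ≡ t * (x + x)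
  1-x²≡t[x+x] = begin
    1ℚ - x * x                         ≡⟨ solve 2 (λ s t → con 1ℚ :- (s :- t) :* (s :- t) := (con 1ℚ :+ t :* t) :- s :* s :+ t :* ((s :- t) :+ (s :- t))) refl s t ⟩
    (1ℚ + t * t) - s * s + t * (x + x) ≡⟨ cong (λ y → y - s * s + t * (x + x)) s²≡1+t² ⟨
    s * s - s * s + t * (x + x)        ≡⟨ solve 3 (λ s t x → s :* s :- s :* s :+ t :* (x :+ x) := t :* (x :+ x)) refl s t x ⟩
    t * (x + x)                        ∎

  x≢0 : x ≢ 0ℚ
  x≢0 x≡0 = 1≢0 (begin
    1ℚ          ≡⟨ cong (λ y → 1ℚ - y * y) x≡0 ⟨
    1ℚ - x * x  ≡⟨ 1-x²≡t[x+x] ⟩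
    t * (x + x) ≡⟨ cong (λ y → t * (y + y)) x≡0 ⟩
    t * 0ℚ      ≡⟨ *-zeroʳ t ⟩
    0ℚ          ∎)

  gx≡t : g x x≢0 ≡ t
  gx≡t = g≡-intro x x≢0 1-x²≡t[x+x]

  x≢±1 : ¬ (x ≡ 1ℚ ⊎ x ≡ - 1ℚ)
  x≢±1 x≡±1 = t≢0 (trans (sym gx≡t)
    (g≡-intro x x≢0 (trans (x≡±1⇒1-x*x≡0 x≡±1) (sym (*-zeroˡ (x + x))))))

-- A perfect cuboid scaled to edges X, Y, 1 (up to sign), with Z the diagonal of the X–Y face.
UnitEdgeCuboid : Set
UnitEdgeCuboid = ∃ λ X → ∃ λ Y → ∃ λ Z →
  UnitLeg X × UnitLeg Y × UnitLeg Z × X * X + Y * Y ≡ Z * Z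

perfectCuboid⇒unitEdgeCuboid : PerfectCuboidExists → UnitEdgeCuboid
perfectCuboid⇒unitEdgeCuboid (a , b , c , cuboid) =
  a ÷ c , b ÷ c , d ÷ c ,
  unitLeg-÷ a c (positive⇒≢0 a-pos) ac-sq ,
  unitLeg-÷ b c (positive⇒≢0 b-pos) bc-sq ,
  unitLeg-÷ d c d≢0 (subst IsSquare (cong (_+ c * c) (sym d²≡a²+b²)) abc-sq) ,
  sym (scale-pythagorean {a} {b} {d} (1/ c) d²≡a²+b²)
  where
  open PerfectCuboid cuboid
  instance _ = >-nonZero c-pos
  positive⇒≢0 : ∀ {p} → 0ℚ < p → p ≢ 0ℚ
  positive⇒≢0 = ≢-sym ∘ <⇒≢
  d : ℚ
  d = proj₁ ab-sq
  d²≡a²+b² : d * d ≡ a * a + b * b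
  d²≡a²+b² = proj₂ ab-sq
  d≢0 : d ≢ 0ℚ
  d≢0 d≡0 = positive⇒≢0 (positive⁻¹ (a * a + b * b) {{a²+b²-positive}}) (begin
    a * a + b * b ≡⟨ d²≡a²+b² ⟨
    d * d         ≡⟨ cong (λ y → y * y) d≡0 ⟩
    0ℚ            ∎)
    where
    a²+b²-positive : Positive (a * a + b * b)
    a²+b²-positive = pos+pos⇒pos (a * a) {{pos*pos⇒pos a a}} (b * b) {{pos*pos⇒pos b b}}
      where instance
        _ : Positive a
        _ = positive a-pos
        _ : Positive b
        _ = positive b-pos

unitEdgeCuboid⇒perfectCuboid : UnitEdgeCuboid → PerfectCuboidExists
unitEdgeCuboid⇒perfectCuboid (X , Y , Z , (X≢0 , 1+X²-sq) , (Y≢0 , 1+Y²-sq) , (_ , 1+Z²-sq) , X²+Y²≡Z²) =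
  ∣ X ∣ , ∣ Y ∣ , 1ℚ , record
    { a-pos  = 0<∣p∣ X≢0
    ; b-pos  = 0<∣p∣ Y≢0
    ; c-pos  = positive⁻¹ 1ℚ
    ; ab-sq  = Z , trans (sym X²+Y²≡Z²) X²+Y²≡∣X∣²+∣Y∣²
    ; bc-sq  = 1+-square-comm (sym (∣p∣*∣p∣≡p*p Y)) 1+Y²-sq
    ; ac-sq  = 1+-square-comm (sym (∣p∣*∣p∣≡p*p X)) 1+X²-sq
    ; abc-sq = 1+-square-comm (trans (sym X²+Y²≡Z²) X²+Y²≡∣X∣²+∣Y∣²) 1+Z²-sq
    }
  where
  X²+Y²≡∣X∣²+∣Y∣² : X * X + Y * Y ≡ ∣ X ∣ * ∣ X ∣ + ∣ Y ∣ * ∣ Y ∣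
  X²+Y²≡∣X∣²+∣Y∣² = sym (cong₂ _+_ (∣p∣*∣p∣≡p*p X) (∣p∣*∣p∣≡p*p Y))
  1+-square-comm : ∀ {u v} → u ≡ v → IsSquare (1ℚ + u) → IsSquare (v + 1ℚ * 1ℚ)
  1+-square-comm {u} u≡v = subst IsSquare (trans (+-comm 1ℚ u) (cong (_+ 1ℚ) u≡v))

equation⇒unitEdgeCuboid : CuboidEquation → UnitEdgeCuboid
equation⇒unitEdgeCuboid (α , β , γ , hα , hβ , hγ , equation) =
  g γ (proj₁ hγ) , g β (proj₁ hβ) , g α (proj₁ hα) ,
  unitLeg-g γ hγ , unitLeg-g β hβ , unitLeg-g α hα , equation

unitEdgeCuboid⇒equation : UnitEdgeCuboid → CuboidEquation
unitEdgeCuboid⇒equation (X , Y , Z , X-leg , Y-leg , Z-leg , X²+Y²≡Z²) =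
  combine (unitLeg⇒g-fibre X-leg) (unitLeg⇒g-fibre Y-leg) (unitLeg⇒g-fibre Z-leg)
  where
  combine : Fibre-g X → Fibre-g Y → Fibre-g Z → CuboidEquation
  combine (γ , hγ , gγ≡X) (β , hβ , gβ≡Y) (α , hα , gα≡Z) = α , β , γ , hα , hβ , hγ , (begin
    g γ (proj₁ hγ) * g γ (proj₁ hγ) + g β (proj₁ hβ) * g β (proj₁ hβ) ≡⟨ cong₂ (λ u v → u * u + v * v) gγ≡X gβ≡Y ⟩
    X * X + Y * Y                                                     ≡⟨ X²+Y²≡Z² ⟩
    Z * Z                                                             ≡⟨ cong (λ w → w * w) gα≡Z ⟨
    g α (proj₁ hα) * g α (proj₁ hα)                                   ∎)

theorem3 : (PerfectCuboidExists → CuboidEquation) × (CuboidEquation → PerfectCuboidExists)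
theorem3 = unitEdgeCuboid⇒equation ∘ perfectCuboid⇒unitEdgeCuboid
         , unitEdgeCuboid⇒perfectCuboid ∘ equation⇒unitEdgeCuboid
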